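{- Let $\sigma$ be a simple permutation of size $n \geq 4$ and let $\tau$ be a simple permutation of size $n+1$ such that $\sigma \preceq \tau$. Then there is only one way to obtain $\tau$ by adding a point to $\sigma$; equivalently, there is exactly one position $k \in \{1,\dots,n+1\}$ such that deleting the entry $\tau_k$ from $\tau$ and standardizing yields $\sigma$.
   Context: A permutation of size $n$ is a bijection $\sigma$ of $\{1,\dots,n\}$, written $\sigma=\sigma_1\cdots\sigma_n$. A permutation $\pi$ of size $k$ is a pattern of $\sigma$, written $\pi \preceq \sigma$, if there exist indices $i_1<\dots<i_k$ with $\sigma_{i_1}\cdots\sigma_{i_k}$ order-isomorphic to $\pi$. Standardizing a word of distinct integers means replacing it by the order-isomorphic permutation. An interval of $\sigma$ is a set of consecutive positions $\{i,\dots,j\}$ such that $\{\sigma_i,\dots,\sigma_j\}$ is a set of consecutive integers; $\sigma$ is simple if its only intervals are singletons and the whole set of positions. -}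

module Defs where

open import Data.Nat using (ℕ; suc)
open import Data.Fin using (Fin; toℕ; punchIn; _<_; _≤_)
open import Data.Product using (Σ; ∃; _×_; _,_)
open import Data.Sum using (_⊎_)
open import Relation.Binary.PropositionalEquality using (_≡_)
open import Function.Definitions using (Bijective)
open import Function.Bundles using (_⇔_)

-- A permutation of size n: a bijection of {0,…,n-1} (positions ↦ values).
Perm : ℕ → Set
Perm n = Σ (Fin n → Fin n) (Bijective _≡_ _≡_)

_at_ : ∀ {n} → Perm n → Fin n → Fin n
(σ , _) at i = σ i

OrderIso : ∀ {k m l} → (Fin k → Fin m) → (Fin k → Fin l) → Set
OrderIso {k} w v = ∀ (i j : Fin k) → (w i < w j) ⇔ (v i < v j)

_≼_ : ∀ {k n} → Perm k → Perm n → Set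
_≼_ {k} {n} π σ =
  Σ (Fin k → Fin n) λ e →
    (∀ (i j : Fin k) → i < j → e i < e j) ×
    OrderIso (π at_) (λ i → σ at (e i))

-- {i,…,j} (with i ≤ j) is an interval of σ: its value set is a set of consecutive integers,
-- i.e. every value between two values taken on the block is taken on the block
IsInterval : ∀ {n} → Perm n → Fin n → Fin n → Set
IsInterval {n} σ i j =
  i ≤ j ×
  (∀ (p q : Fin n) (v : Fin n) →
     i ≤ p → p ≤ j → i ≤ q → q ≤ j →
     σ at p ≤ v → v ≤ σ at q →
     ∃ λ r → i ≤ r × r ≤ j × σ at r ≡ v)

Simple : ∀ {n} → Perm n → Set
Simple {n} σ =
  ∀ (i j : Fin n) → IsInterval σ i j →
    i ≡ j ⊎ (toℕ i ≡ 0 × suc (toℕ j) ≡ n)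

-- deleting the entry at position k of τ and standardizing yields σ
-- (the remaining word, indexed via punchIn k, is order-isomorphic to σ)
DeleteYields : ∀ {n} → Perm (suc n) → Fin (suc n) → Perm n → Set
DeleteYields τ k σ = OrderIso (σ at_) (λ i → τ at (punchIn k i))

-- If deleting the entries at positions a < b of τ gives order-isomorphic words, then
-- comparing the neighbouring positions c - 1 and c through the two deletions shows that
-- every entry in the block [a, b] lies on the same side of every entry outside it, so
-- [a, b] is an interval.  For simple τ the block is therefore all of τ, and then the two
-- words are τ without its first and without its last entry.  These are order-isomorphic
-- only if the maximum of τ sits at an end, but then the remaining entries form an interval.
-- Existence is clear: an increasing embedding of n positions into n + 1 omits one position.
module Submission where

open import Defs
open import Data.Nat using (ℕ; suc; _≥_)
open import Data.Fin using (Fin)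
open import Data.Product using (∃; _×_)
open import Relation.Binary.PropositionalEquality using (_≡_)

import Data.Nat as ℕ
import Data.Nat.Properties as ℕ
open import Data.Nat using (zero; z≤n; s≤s)
open import Data.Fin
  using (zero; suc; toℕ; fromℕ; inject₁; lower₁; punchIn; punchOut; _<_; _≤_)
open import Data.Fin.Properties
  using ( _≟_; _≤?_; _<?_; <-cmp; <-irrefl; <⇒≢; suc-injective
        ; toℕ-injective; toℕ<n; toℕ≤pred[n]; toℕ-fromℕ; ≤fromℕ
        ; toℕ-inject₁; toℕ-inject₁-≢; toℕ-lower₁; inject₁-lower₁
        ; punchIn-punchOut; injective⇒≤ )
open import Data.Fin.Induction using (<-weakInduction-startingFrom)
open import Data.Product using (_,_; proj₁; proj₂)
open import Data.Sum using (_⊎_; inj₁; inj₂; [_,_])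
open import Function.Base using (_∘_)
open import Function.Bundles using (_⇔_; Equivalence)
open import Function.Definitions using (Injective)
import Function.Properties.Equivalence as ⇔
open import Relation.Binary.Definitions using (tri<; tri≈; tri>)
open import Relation.Binary.PropositionalEquality
  using (_≢_; _≗_; refl; sym; trans; cong; subst; subst₂)
open import Relation.Nullary using (¬_; yes; no; contradiction)

open Equivalence using (to; from)

private
  variable
    k m n : ℕ

at-injective : (τ : Perm n) → Injective _≡_ _≡_ (τ at_)
at-injective (_ , injective , _) = injective

preimage : (τ : Perm n) (v : Fin n) → ∃ λ r → τ at r ≡ v
preimage (_ , _ , surjective) v = proj₁ (surjective v) , proj₂ (surjective v) refl

at-<-maximum : (τ : Perm (suc n)) {m r : Fin (suc n)} →
               τ at m ≡ fromℕ n → r ≢ m → τ at r < τ at m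
at-<-maximum τ {r = r} τm≡max r≢m = ℕ.≤∧≢⇒<
  (subst (τ at r ≤_) (sym τm≡max) (≤fromℕ (τ at r)))
  (r≢m ∘ at-injective τ ∘ toℕ-injective)

≢fromℕ⇒< : {r : Fin (suc n)} → r ≢ fromℕ n → toℕ r ℕ.< n
≢fromℕ⇒< {n} {r} r≢last =
  ℕ.≤∧≢⇒< (toℕ≤pred[n] r)
          (r≢last ∘ toℕ-injective ∘ λ r≡n → trans r≡n (sym (toℕ-fromℕ n)))

OrderIso-sym : {w : Fin k → Fin m} {v : Fin k → Fin n} → OrderIso w v → OrderIso v w
OrderIso-sym w≅v i j = ⇔.sym (w≅v i j)

OrderIso-trans : ∀ {l} {u : Fin k → Fin l} {w : Fin k → Fin m} {v : Fin k → Fin n} →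
                 OrderIso u w → OrderIso w v → OrderIso u v
OrderIso-trans u≅w w≅v i j = ⇔.trans (u≅w i j) (w≅v i j)

OrderIso-respʳ : {w : Fin k → Fin m} {v v′ : Fin k → Fin n} →
                 v ≗ v′ → OrderIso w v → OrderIso w v′
OrderIso-respʳ {w = w} v≗v′ w≅v i j =
  subst₂ (λ x y → (w i < w j) ⇔ (x < y)) (v≗v′ i) (v≗v′ j) (w≅v i j)

Increasing : (Fin k → Fin m) → Set
Increasing {k} e = ∀ (i j : Fin k) → i < j → e i < e j

increasing-injective : {e : Fin k → Fin m} → Increasing e → Injective _≡_ _≡_ e
increasing-injective {e = e} increasing {i} {j} eᵢ≡eⱼ with <-cmp i j
... | tri< i<j _ _ = contradiction eᵢ≡eⱼ (<⇒≢ (increasing i j i<j))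
... | tri≈ _ i≡j _ = i≡j
... | tri> _ _ j<i = contradiction (sym eᵢ≡eⱼ) (<⇒≢ (increasing j i j<i))

increasing-tail : {e : Fin (suc k) → Fin m} → Increasing e → Increasing (e ∘ suc)
increasing-tail increasing i j i<j = increasing (suc i) (suc j) (s≤s i<j)

increasing-tail≢0 : {e : Fin (suc k) → Fin (suc m)} → Increasing e → ∀ i → zero ≢ e (suc i)
increasing-tail≢0 {e = e} increasing i 0≡eᵢ₊₁ =
  ℕ.n≮0 (subst (e zero <_) (sym 0≡eᵢ₊₁) (increasing zero (suc i) (s≤s z≤n)))

increasing-≢0 : {e : Fin (suc k) → Fin (suc m)} → Increasing e →
                zero ≢ e zero → ∀ i → zero ≢ e i
increasing-≢0 increasing 0≢e₀ zero    = 0≢e₀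
increasing-≢0 increasing 0≢e₀ (suc i) = increasing-tail≢0 increasing i

punchOut₀-mono-< : {i j : Fin (suc m)} (0≢i : zero ≢ i) (0≢j : zero ≢ j) →
                   i < j → punchOut 0≢i < punchOut 0≢j
punchOut₀-mono-< {i = zero}              0≢i _   _         = contradiction refl 0≢i
punchOut₀-mono-< {i = suc _} {j = zero}  _   0≢j _         = contradiction refl 0≢j
punchOut₀-mono-< {i = suc _} {j = suc _} _   _   (s≤s i<j) = i<j

lowered : (e : Fin k → Fin (suc m)) → (∀ i → zero ≢ e i) → Fin k → Fin m
lowered e e≢0 i = punchOut (e≢0 i)

lowered-increasing : {e : Fin k → Fin (suc m)} (e≢0 : ∀ i → zero ≢ e i) →
                     Increasing e → Increasing (lowered e e≢0)
lowered-increasing e≢0 increasing i j i<j = punchOut₀-mono-< (e≢0 i) (e≢0 j) (increasing i j i<j)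

suc-lowered : {e : Fin k → Fin (suc m)} (e≢0 : ∀ i → zero ≢ e i) →
              ∀ i → suc (lowered e e≢0 i) ≡ e i
suc-lowered e≢0 i = punchIn-punchOut (e≢0 i)

increasing-endo≗id : (e : Fin n → Fin n) → Increasing e → e ≗ (λ i → i)
increasing-endo≗id {suc n} e increasing with zero ≟ e zero
... | no 0≢e₀ = contradiction (injective⇒≤ lowered-injective) ℕ.1+n≰n
  where
  e≢0 = increasing-≢0 increasing 0≢e₀
  lowered-injective : Injective _≡_ _≡_ (lowered e e≢0)
  lowered-injective = increasing-injective (lowered-increasing e≢0 increasing)
... | yes 0≡e₀ = e≗id
  where
  e≢0 = increasing-tail≢0 increasing
  lowered≗id = increasing-endo≗id _ (lowered-increasing e≢0 (increasing-tail increasing))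
  e≗id : e ≗ (λ i → i)
  e≗id zero    = sym 0≡e₀
  e≗id (suc i) = trans (sym (suc-lowered e≢0 i)) (cong suc (lowered≗id i))

increasing⇒punchIn : (e : Fin n → Fin (suc n)) → Increasing e → ∃ λ k → e ≗ punchIn k
increasing⇒punchIn {zero}  e increasing = zero , λ ()
increasing⇒punchIn {suc n} e increasing with zero ≟ e zero
... | no 0≢e₀ = zero , λ i →
  trans (sym (suc-lowered e≢0 i))
        (cong suc (increasing-endo≗id _ (lowered-increasing e≢0 increasing) i))
  where
  e≢0 = increasing-≢0 increasing 0≢e₀
... | yes 0≡e₀ with increasing⇒punchIn _ (lowered-increasing e≢0 (increasing-tail increasing))
  where
  e≢0 = increasing-tail≢0 increasing
...   | k , lowered≗punchIn = suc k , e≗punchIn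
  where
  e≗punchIn : e ≗ punchIn (suc k)
  e≗punchIn zero    = sym 0≡e₀
  e≗punchIn (suc i) =
    trans (sym (suc-lowered (increasing-tail≢0 increasing) i)) (cong suc (lowered≗punchIn i))

punchIn≡inject₁ : (i : Fin (suc n)) (j : Fin n) → j < i → punchIn i j ≡ inject₁ j
punchIn≡inject₁ (suc i) zero    _         = refl
punchIn≡inject₁ (suc i) (suc j) (s≤s j<i) = cong suc (punchIn≡inject₁ i j j<i)

punchIn≡suc : (i : Fin (suc n)) (j : Fin n) → i ≤ j → punchIn i j ≡ suc j
punchIn≡suc zero    j       _         = refl
punchIn≡suc (suc i) (suc j) (s≤s i≤j) = cong suc (punchIn≡suc i j i≤j)

Outside : (a b d : Fin n) → Set
Outside a b d = d < a ⊎ b < d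

inside-or-outside : (a b r : Fin n) → (a ≤ r × r ≤ b) ⊎ Outside a b r
inside-or-outside a b r with r <? a | b <? r
... | yes r<a | _       = inj₂ (inj₁ r<a)
... | no _    | yes b<r = inj₂ (inj₂ b<r)
... | no r≮a  | no b≮r  = inj₁ (ℕ.≮⇒≥ r≮a , ℕ.≮⇒≥ b≮r)

outside-≢-inside : {a b d c : Fin n} → Outside a b d → a ≤ c → c ≤ b → d ≢ c
outside-≢-inside (inj₁ d<a) a≤c _   refl = ℕ.<⇒≱ d<a a≤c
outside-≢-inside (inj₂ b<d) _   c≤b refl = ℕ.<⇒≱ b<d c≤b

punchIn-outside : {a b d : Fin (suc n)} → a < b → Outside a b d →
                  ∃ λ y → punchIn a y ≡ d × punchIn b y ≡ d
punchIn-outside {n} {a} {b} {d} a<b (inj₁ d<a) =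
  y , below a y<a , below b (ℕ.<-trans y<a a<b)
  where
  n≢d : n ≢ toℕ d
  n≢d = ℕ.>⇒≢ (ℕ.<-≤-trans d<a (toℕ≤pred[n] a))
  y = lower₁ d n≢d
  y<a : y < a
  y<a = subst (ℕ._< toℕ a) (sym (toℕ-lower₁ d n≢d)) d<a
  below : ∀ c → y < c → punchIn c y ≡ d
  below c y<c = trans (punchIn≡inject₁ c y y<c) (inject₁-lower₁ d n≢d)
punchIn-outside {a = a} {b} {suc y} a<b (inj₂ b<d) =
  y , punchIn≡suc a y (ℕ.≤-trans (ℕ.<⇒≤ a<b) b≤y) , punchIn≡suc b y b≤y
  where
  b≤y = ℕ.s≤s⁻¹ b<d

deletion : Perm (suc n) → Fin (suc n) → Fin n → Fin (suc n)
deletion τ k i = τ at punchIn k i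

module DeletionsAgree (τ : Perm (suc n)) {a b : Fin (suc n)} (a<b : a < b)
                      (agree : OrderIso (deletion τ a) (deletion τ b)) where

  adjacent-same-side : ∀ {x d} → a ≤ x → x < b → Outside a b d →
                       (τ at suc x < τ at d) ⇔ (τ at inject₁ x < τ at d)
  adjacent-same-side {x} {d} a≤x x<b d-out =
    subst₂ (λ c c′ → (τ at c < τ at d) ⇔ (τ at c′ < τ at d))
           (punchIn≡suc a x a≤x) (punchIn≡inject₁ b x x<b)
           (subst₂ (λ e e′ → (τ at punchIn a x < τ at e) ⇔ (τ at punchIn b x < τ at e′))
                   a↑y≡d b↑y≡d (agree x y))
    where
    y = proj₁ (punchIn-outside a<b d-out)
    a↑y≡d = proj₁ (proj₂ (punchIn-outside a<b d-out))
    b↑y≡d = proj₂ (proj₂ (punchIn-outside a<b d-out))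

  block-same-side : ∀ {c d} → a ≤ c → c ≤ b → Outside a b d →
                    (τ at c < τ at d) ⇔ (τ at a < τ at d)
  block-same-side {d = d} a≤c c≤b d-out =
    <-weakInduction-startingFrom SameSide (λ _ _ → ⇔.refl) step a≤c a≤c c≤b
    where
    SameSide : Fin (suc n) → Set
    SameSide c = a ≤ c → c ≤ b → (τ at c < τ at d) ⇔ (τ at a < τ at d)
    step : ∀ j → SameSide (inject₁ j) → SameSide (suc j)
    step j IH a≤1+j 1+j≤b with a ≤? j
    ... | yes a≤j = ⇔.trans (adjacent-same-side a≤j 1+j≤b d-out)
                            (IH (subst (toℕ a ℕ.≤_) (sym (toℕ-inject₁ j)) a≤j)
                                (subst (ℕ._≤ toℕ b) (sym (toℕ-inject₁ j)) (ℕ.<⇒≤ 1+j≤b)))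
    ... | no a≰j = subst (λ c → (τ at c < τ at d) ⇔ (τ at a < τ at d)) a≡1+j ⇔.refl
      where
      a≡1+j : a ≡ suc j
      a≡1+j = toℕ-injective (ℕ.≤-antisym a≤1+j (ℕ.≰⇒> a≰j))

  interval : IsInterval τ a b
  interval = ℕ.<⇒≤ a<b , fill
    where
    fill : ∀ p q v → a ≤ p → p ≤ b → a ≤ q → q ≤ b → τ at p ≤ v → v ≤ τ at q →
           ∃ λ r → a ≤ r × r ≤ b × τ at r ≡ v
    fill p q v a≤p p≤b a≤q q≤b τp≤v v≤τq with preimage τ v
    ... | r , τr≡v with inside-or-outside a b r
    ...   | inj₁ (a≤r , r≤b) = r , a≤r , r≤b , τr≡v
    ...   | inj₂ r-out = contradiction (subst (_≤ τ at q) (sym τr≡v) v≤τq) (ℕ.<⇒≱ τq<τr)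
      where
      τp<τr : τ at p < τ at r
      τp<τr = ℕ.≤∧≢⇒< (subst (τ at p ≤_) (sym τr≡v) τp≤v)
                      (outside-≢-inside r-out a≤p p≤b ∘ sym ∘ at-injective τ ∘ toℕ-injective)
      τq<τr : τ at q < τ at r
      τq<τr = from (block-same-side a≤q q≤b r-out) (to (block-same-side a≤p p≤b r-out) τp<τr)

interval-avoiding-maximum : (τ : Perm (suc n)) {m i j : Fin (suc n)} → τ at m ≡ fromℕ n → i ≤ j →
                            (∀ r → r ≢ m → i ≤ r × r ≤ j) → ¬ (i ≤ m × m ≤ j) → IsInterval τ i j
interval-avoiding-maximum τ {m} {i} {j} τm≡max i≤j covers m∉ij = i≤j , fill
  where
  fill : ∀ p q v → i ≤ p → p ≤ j → i ≤ q → q ≤ j → τ at p ≤ v → v ≤ τ at q →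
         ∃ λ r → i ≤ r × r ≤ j × τ at r ≡ v
  fill p q v _ _ i≤q q≤j _ v≤τq with preimage τ v
  ... | r , τr≡v = r , proj₁ (covers r r≢m) , proj₂ (covers r r≢m) , τr≡v
    where
    q≢m : q ≢ m
    q≢m refl = m∉ij (i≤q , q≤j)
    r≢m : r ≢ m
    r≢m refl = ℕ.<⇒≱ (at-<-maximum τ τm≡max q≢m) (subst (_≤ τ at q) (sym τr≡v) v≤τq)

maximum-not-first : (τ : Perm (suc (suc (suc n)))) {m : Fin (suc (suc (suc n)))} →
                    Simple τ → τ at m ≡ fromℕ (suc (suc n)) → m ≢ zero
maximum-not-first {n} τ simple τm≡max refl
  with simple (suc zero) last (interval-avoiding-maximum τ τm≡max (s≤s z≤n) covers (λ ()))
  where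
  last = fromℕ (suc (suc n))
  covers : ∀ (r : Fin (suc (suc (suc n)))) → r ≢ zero → suc (zero {suc n}) ≤ r × r ≤ last
  covers zero    r≢0 = contradiction refl r≢0
  covers (suc r) _   = s≤s z≤n , ≤fromℕ (suc r)
... | inj₁ ()
... | inj₂ (() , _)

maximum-not-last : (τ : Perm (suc (suc (suc n)))) {m : Fin (suc (suc (suc n)))} →
                   Simple τ → τ at m ≡ fromℕ (suc (suc n)) → m ≢ fromℕ (suc (suc n))
maximum-not-last {n} τ simple τm≡max refl
  with simple zero penultimate (interval-avoiding-maximum τ τm≡max z≤n covers last∉)
  where
  last = fromℕ (suc (suc n))
  penultimate = inject₁ (fromℕ (suc n))
  toℕ-penultimate : toℕ penultimate ≡ suc n
  toℕ-penultimate = trans (toℕ-inject₁ (fromℕ (suc n))) (toℕ-fromℕ (suc n))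
  covers : ∀ (r : Fin (suc (suc (suc n)))) → r ≢ last → zero {suc (suc n)} ≤ r × r ≤ penultimate
  covers r r≢last = z≤n , subst (toℕ r ℕ.≤_) (sym toℕ-penultimate) (ℕ.s≤s⁻¹ (≢fromℕ⇒< r≢last))
  last∉ : ¬ (zero {suc (suc n)} ≤ last × last ≤ penultimate)
  last∉ (_ , last≤penultimate) =
    ℕ.1+n≰n (subst₂ ℕ._≤_ (toℕ-fromℕ (suc (suc n))) toℕ-penultimate last≤penultimate)
... | inj₁ ()
... | inj₂ (_ , 1+penultimate≡size) =
  toℕ-inject₁-≢ (fromℕ (suc n)) (sym (ℕ.suc-injective 1+penultimate≡size))

-- For interior m the first word peaks at index m - 1, so the second word would too; but its
-- entry at index m is the maximum τ m.
maximum-at-end : (τ : Perm (suc n)) {m : Fin (suc n)} →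
                 OrderIso (deletion τ zero) (deletion τ (fromℕ n)) →
                 τ at m ≡ fromℕ n → m ≡ zero ⊎ m ≡ fromℕ n
maximum-at-end τ {zero} _ _ = inj₁ refl
maximum-at-end {n} τ {suc m₀} agree τm≡max with suc m₀ ≟ fromℕ n
... | yes m≡last = inj₂ m≡last
... | no  m≢last = contradiction (subst (τ at y ≤_) (sym τm≡max) (≤fromℕ (τ at y))) (ℕ.<⇒≱ τm<τy)
  where
  n≢m : n ≢ toℕ (suc m₀)
  n≢m = ℕ.>⇒≢ (≢fromℕ⇒< m≢last)
  x = lower₁ (suc m₀) n≢m
  y = punchIn (fromℕ n) m₀
  1+x≢m : suc x ≢ suc m₀
  1+x≢m 1+x≡m = ℕ.1+n≢n (trans (sym (toℕ-lower₁ (suc m₀) n≢m)) (cong toℕ (suc-injective 1+x≡m)))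
  last↑x≡m : punchIn (fromℕ n) x ≡ suc m₀
  last↑x≡m = trans (punchIn≡inject₁ (fromℕ n) x (subst (toℕ x ℕ.<_) (sym (toℕ-fromℕ n)) (toℕ<n x)))
                   (inject₁-lower₁ (suc m₀) n≢m)
  τm<τy : τ at suc m₀ < τ at y
  τm<τy = subst (λ c → τ at c < τ at y) last↑x≡m (to (agree x m₀) (at-<-maximum τ τm≡max 1+x≢m))

simple⇒deletions-disagree : (τ : Perm (suc (suc (suc n)))) {a b : Fin (suc (suc (suc n)))} →
                            Simple τ → a < b → ¬ OrderIso (deletion τ a) (deletion τ b)
simple⇒deletions-disagree {n} τ {a} {b} simple a<b agree
  with simple a b (DeletionsAgree.interval τ a<b agree)
... | inj₁ a≡b = <-irrefl a≡b a<b
... | inj₂ (a≡0 , 1+b≡size) =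
  [ maximum-not-first τ simple τm≡max , maximum-not-last τ simple τm≡max ]
    (maximum-at-end τ first-last-agree τm≡max)
  where
  τm≡max = proj₂ (preimage τ (fromℕ (suc (suc n))))
  b≡last : b ≡ fromℕ (suc (suc n))
  b≡last = toℕ-injective (trans (ℕ.suc-injective 1+b≡size) (sym (toℕ-fromℕ (suc (suc n)))))
  first-last-agree : OrderIso (deletion τ zero) (deletion τ (fromℕ (suc (suc n))))
  first-last-agree =
    subst₂ (λ a b → OrderIso (deletion τ a) (deletion τ b)) (toℕ-injective a≡0) b≡last agree

simple⇒deletion-position-unique : (τ : Perm (suc (suc (suc n)))) {a b : Fin (suc (suc (suc n)))} →
                                  Simple τ → OrderIso (deletion τ a) (deletion τ b) → a ≡ b
simple⇒deletion-position-unique τ {a} {b} simple agree with <-cmp a b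
... | tri< a<b _ _ = contradiction agree (simple⇒deletions-disagree τ simple a<b)
... | tri≈ _ a≡b _ = a≡b
... | tri> _ _ b<a = contradiction (OrderIso-sym agree) (simple⇒deletions-disagree τ simple b<a)

proposition4p5 : (n : ℕ) → n ≥ 4 → (σ : Perm n) → (τ : Perm (suc n)) →
    Simple σ → Simple τ → σ ≼ τ →
    ∃ λ (k : Fin (suc n)) → DeleteYields τ k σ × (∀ (k′ : Fin (suc n)) → DeleteYields τ k′ σ → k′ ≡ k)
proposition4p5 zero          ()
proposition4p5 (suc zero)    (s≤s ())
proposition4p5 (suc (suc n)) _ σ τ _ τ-simple (e , e-increasing , σ≅τ∘e)
  with increasing⇒punchIn e e-increasing
... | k , e≗punchIn = k , deletion-k , unique
  where
  deletion-k : DeleteYields τ k σ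
  deletion-k = OrderIso-respʳ (cong (τ at_) ∘ e≗punchIn) σ≅τ∘e
  unique : ∀ k′ → DeleteYields τ k′ σ → k′ ≡ k
  unique k′ deletion-k′ =
    simple⇒deletion-position-unique τ τ-simple (OrderIso-trans (OrderIso-sym deletion-k′) deletion-k)
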